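{- Let $n\ge1$. The map $Q:\mathrm{Sym}(n+1)\to\mathrm{GL}((\mathbb{Z}/2\mathbb{Z})^{n+1})$, $\sigma\mapsto Q(\sigma)$, is an injective group morphism.
   Context: $\mathrm{Sym}(n+1)$ is the group of bijections of $\{1,\dots,n+1\}$ with product $\sigma\cdot\rho:=\rho\circ\sigma$; $(i\ j)$ is a transposition. $\delta_{i,j}\in\mathbb{Z}/2\mathbb{Z}$ is the Kronecker delta; all arithmetic is in $\mathbb{Z}/2\mathbb{Z}$. $Q(\sigma)$ is the $(n+1)\times(n+1)$ matrix with entries $Q(\sigma)_{i,j}=\delta_{(n+1\ \sigma(n+1))(\sigma(i)),\,j}+\delta_{\sigma(n+1),j}(1+\delta_{n+1,\sigma(i)})(1+\delta_{\sigma(n+1),n+1})$, where $(n+1\ \sigma(n+1))$ is the identity when $\sigma(n+1)=n+1$. $\mathrm{GL}((\mathbb{Z}/2\mathbb{Z})^{n+1})$ has product matrix multiplication; matrices act on column vectors. -}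

module Defs where

open import Data.Nat.Base using (ℕ; zero; suc)
open import Data.Fin.Base using (Fin; zero; suc; fromℕ)
open import Data.Fin.Properties using (_≟_)
open import Data.Fin.Permutation using (Permutation′; _⟨$⟩ʳ_; _∘ₚ_; _≈_)
import Data.Fin.Permutation.Components as PC
open import Data.Bool.Base using (Bool; true; false; _xor_; _∧_; not)
open import Relation.Nullary using (does)
open import Relation.Binary.PropositionalEquality using (_≡_)

-- Z/2Z is modelled by Bool: addition = xor, multiplication = ∧.

-- Sym(n+1): permutations of Fin (suc n)  (point k ∈ {1..n+1} is Fin index k-1,
-- so the point n+1 is  fromℕ n).
Sym : ℕ → Set
Sym n = Permutation′ (suc n)

-- Group product in Sym(n+1):  σ · ρ := ρ ∘ σ  (apply σ first, then ρ).
-- (σ ∘ₚ ρ) ⟨$⟩ʳ i = ρ ⟨$⟩ʳ (σ ⟨$⟩ʳ i).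
_·_ : ∀ {n} → Sym n → Sym n → Sym n
σ · ρ = σ ∘ₚ ρ

δ : ∀ {m} → Fin m → Fin m → Bool
δ i j = does (i ≟ j)

Mat : ℕ → Set
Mat m = Fin m → Fin m → Bool

Σ2 : ∀ {m} → (Fin m → Bool) → Bool
Σ2 {zero} f = false
Σ2 {suc m} f = f zero xor Σ2 (λ i → f (suc i))

_*M_ : ∀ {m} → Mat m → Mat m → Mat m
(A *M B) i j = Σ2 (λ k → A i k ∧ B k j)

1M : ∀ {m} → Mat m
1M i j = δ i j

_≡M_ : ∀ {m} → Mat m → Mat m → Set
A ≡M B = ∀ i j → A i j ≡ B i j

record Invertible {m : ℕ} (A : Mat m) : Set where
  field
    inv   : Mat m
    invˡ  : (inv *M A) ≡M 1M
    invʳ  : (A *M inv) ≡M 1M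

top : ∀ n → Fin (suc n)
top n = fromℕ n

Q : ∀ {n} → Sym n → Mat (suc n)
Q {n} σ i j =
  δ (PC.transpose (top n) (σ ⟨$⟩ʳ top n) (σ ⟨$⟩ʳ i)) j
  xor (δ (σ ⟨$⟩ʳ top n) j
       ∧ (not (δ (top n) (σ ⟨$⟩ʳ i)) ∧ not (δ (σ ⟨$⟩ʳ top n) (top n))))

{-# OPTIONS --safe #-}
-- Let P σ be the permutation matrix of σ (row i is e_σ(i)) and S the shear matrix whose row i is
-- e_i + e_(n+1) for i ≠ n+1 and e_(n+1) for i = n+1.  Over Z/2Z we have S S = 1 and Q σ = S (P σ) S:
-- the transposition (n+1 σ(n+1)) and the correction term in the definition of Q are exactly what
-- the two shears do to the row e_σ(i) of P σ.  As σ ↦ P σ is an injective morphism and conjugation by an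
-- involution is an injective monoid endomorphism, Q is an injective morphism into invertible matrices.
module Submission where

open import Defs
open import Algebra.Bundles using (Monoid; CommutativeRing)
open import Data.Bool.Base using (Bool; true; false; _xor_; _∧_; not)
open import Data.Bool.Properties
  using ( ∧-assoc; ∧-comm; ∧-zeroʳ; ∧-identityʳ; ∧-distribʳ-xor; xor-identityʳ; xor-comm
        ; not-involutive; xor-annihilates-not; xor-∧-commutativeRing)
open import Data.Fin.Base using (Fin; zero; suc)
open import Data.Fin.Permutation using (Permutation′; _⟨$⟩ʳ_; _∘ₚ_; flip; inverseʳ; inverseˡ)
import Data.Fin.Permutation.Components as PC
open import Data.Fin.Properties using (_≟_)
open import Data.Nat.Base as ℕ using (ℕ; _≤_)
open import Data.Product using (_×_; _,_)
open import Function.Base using (_∘_)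
open import Function.Bundles using (Injection)
open import Function.Properties.Inverse using (↔⇒↣)
open import Relation.Binary.PropositionalEquality
  using (_≡_; refl; sym; trans; cong; cong₂; ≢-sym; module ≡-Reasoning)
open import Relation.Nullary using (¬_; Dec; yes; no)
open import Relation.Nullary.Decidable using (dec-true; dec-false)

open import Algebra.Properties.Semiring.Sum (CommutativeRing.semiring xor-∧-commutativeRing)
  using (sum; sum-cong-≗; sum-replicate-zero; ∑-distrib-+; ∑-comm; *-distribˡ-sum; *-distribʳ-sum)

xor-cancelˡ : ∀ x y → x xor (x xor y) ≡ y
xor-cancelˡ false y = refl
xor-cancelˡ true  y = not-involutive y

xor-cancel-middle : ∀ x y z → (x xor y) xor (x xor z) ≡ y xor z
xor-cancel-middle false y z = refl
xor-cancel-middle true  y z = xor-annihilates-not y z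

δ-refl : ∀ {m} (a : Fin m) → δ a a ≡ true
δ-refl a = dec-true (a ≟ a) refl

δ-≢ : ∀ {m} {a b : Fin m} → ¬ a ≡ b → δ a b ≡ false
δ-≢ {a = a} {b} = dec-false (a ≟ b)

δ-sym : ∀ {m} (a b : Fin m) → δ a b ≡ δ b a
δ-sym a b with a ≟ b
... | yes refl = sym (δ-refl a)
... | no a≢b   = sym (δ-≢ (≢-sym a≢b))

δ⇒≡ : ∀ {m} {a b : Fin m} → δ a b ≡ true → a ≡ b
δ⇒≡ {a = a} {b} e with a ≟ b | e
... | yes a≡b | _ = a≡b
... | no _    | ()

δ-permute : ∀ {m} (σ : Permutation′ m) (a b : Fin m) → δ (σ ⟨$⟩ʳ a) (σ ⟨$⟩ʳ b) ≡ δ a b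
δ-permute σ a b with a ≟ b
... | yes refl = δ-refl (σ ⟨$⟩ʳ a)
... | no a≢b   = δ-≢ (a≢b ∘ Injection.injective (↔⇒↣ σ))

transpose-matchˡ : ∀ {m} (s t : Fin m) → PC.transpose s t s ≡ t
transpose-matchˡ s t rewrite δ-refl s = refl

transpose-matchʳ : ∀ {m} {s t : Fin m} → ¬ t ≡ s → PC.transpose s t t ≡ s
transpose-matchʳ {t = t} t≢s rewrite δ-≢ t≢s | δ-refl t = refl

transpose-other : ∀ {m} {s t u : Fin m} → ¬ u ≡ s → ¬ u ≡ t → PC.transpose s t u ≡ u
transpose-other u≢s u≢t rewrite δ-≢ u≢s | δ-≢ u≢t = refl

transpose-self : ∀ {m} (s u : Fin m) → PC.transpose s s u ≡ u
transpose-self s u = by-cases (u ≟ s)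
  where
  by-cases : Dec (u ≡ s) → PC.transpose s s u ≡ u
  by-cases (yes refl) = transpose-matchˡ s s
  by-cases (no u≢s)   = transpose-other u≢s u≢s

Σ2≡sum : ∀ {m} (f : Fin m → Bool) → Σ2 f ≡ sum f
Σ2≡sum {ℕ.zero}  f = refl
Σ2≡sum {ℕ.suc m} f = cong (f zero xor_) (Σ2≡sum (f ∘ suc))

sum-δ : ∀ {m} (a : Fin m) (f : Fin m → Bool) → sum (λ k → δ a k ∧ f k) ≡ f a
sum-δ {ℕ.suc m} zero f = trans (cong (f zero xor_) (sum-replicate-zero m)) (xor-identityʳ (f zero))
sum-δ (suc a) f = sum-δ a (f ∘ suc)

*M-sum : ∀ {m} (A B : Mat m) i j → (A *M B) i j ≡ sum (λ k → A i k ∧ B k j)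
*M-sum A B i j = Σ2≡sum (λ k → A i k ∧ B k j)

module _ {m : ℕ} where

  *M-cong : ∀ {A A′ B B′ : Mat m} → A ≡M A′ → B ≡M B′ → (A *M B) ≡M (A′ *M B′)
  *M-cong {A} {A′} {B} {B′} eA eB i j = begin
    (A *M B) i j                      ≡⟨ *M-sum A B i j ⟩
    sum (λ k → A i k ∧ B k j)         ≡⟨ sum-cong-≗ (λ k → cong₂ _∧_ (eA i k) (eB k j)) ⟩
    sum (λ k → A′ i k ∧ B′ k j)       ≡⟨ *M-sum A′ B′ i j ⟨
    (A′ *M B′) i j                    ∎
    where open ≡-Reasoning

  *M-assoc : ∀ (A B C : Mat m) → ((A *M B) *M C) ≡M (A *M (B *M C))
  *M-assoc A B C i j = begin
    ((A *M B) *M C) i j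
      ≡⟨ *M-sum (A *M B) C i j ⟩
    sum (λ k → (A *M B) i k ∧ C k j)
      ≡⟨ sum-cong-≗ (λ k → cong (_∧ C k j) (*M-sum A B i k)) ⟩
    sum (λ k → sum (λ l → A i l ∧ B l k) ∧ C k j)
      ≡⟨ sum-cong-≗ (λ k → *-distribʳ-sum (C k j) (λ l → A i l ∧ B l k)) ⟩
    sum (λ k → sum (λ l → (A i l ∧ B l k) ∧ C k j))
      ≡⟨ ∑-comm (λ k l → (A i l ∧ B l k) ∧ C k j) ⟩
    sum (λ l → sum (λ k → (A i l ∧ B l k) ∧ C k j))
      ≡⟨ sum-cong-≗ (λ l → sum-cong-≗ (λ k → ∧-assoc (A i l) (B l k) (C k j))) ⟩
    sum (λ l → sum (λ k → A i l ∧ (B l k ∧ C k j)))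
      ≡⟨ sum-cong-≗ (λ l → *-distribˡ-sum (A i l) (λ k → B l k ∧ C k j)) ⟨
    sum (λ l → A i l ∧ sum (λ k → B l k ∧ C k j))
      ≡⟨ sum-cong-≗ (λ l → cong (A i l ∧_) (*M-sum B C l j)) ⟨
    sum (λ l → A i l ∧ (B *M C) l j)
      ≡⟨ *M-sum A (B *M C) i j ⟨
    (A *M (B *M C)) i j
      ∎
    where open ≡-Reasoning

  *M-identityˡ : ∀ (A : Mat m) → (1M *M A) ≡M A
  *M-identityˡ A i j = trans (*M-sum 1M A i j) (sum-δ i (λ k → A k j))

  *M-identityʳ : ∀ (A : Mat m) → (A *M 1M) ≡M A
  *M-identityʳ A i j = begin
    (A *M 1M) i j             ≡⟨ *M-sum A 1M i j ⟩
    sum (λ k → A i k ∧ δ k j) ≡⟨ sum-cong-≗ (λ k → cong (A i k ∧_) (δ-sym k j)) ⟩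
    sum (λ k → A i k ∧ δ j k) ≡⟨ sum-cong-≗ (λ k → ∧-comm (A i k) (δ j k)) ⟩
    sum (λ k → δ j k ∧ A i k) ≡⟨ sum-δ j (A i) ⟩
    A i j                     ∎
    where open ≡-Reasoning

  *M-monoid : Monoid _ _
  *M-monoid = record
    { Carrier  = Mat m
    ; _≈_      = _≡M_
    ; _∙_      = _*M_
    ; ε        = 1M
    ; isMonoid = record
      { isSemigroup = record
        { isMagma = record
          { isEquivalence = record
            { refl  = λ i j → refl
            ; sym   = λ e i j → sym (e i j)
            ; trans = λ e f i j → trans (e i j) (f i j)
            }
          ; ∙-cong = *M-cong
          }
        ; assoc = *M-assoc
        }
      ; identity = *M-identityˡ , *M-identityʳ
      }
    }

module Conjugation {c ℓ} (M : Monoid c ℓ) where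

  open Monoid M using (Carrier; _≈_; _∙_; ε; setoid; assoc; ∙-congˡ; ∙-congʳ; identityˡ; identityʳ)
  open import Relation.Binary.Reasoning.Setoid setoid

  module ByInvolution (d : Carrier) (d∙d≈ε : d ∙ d ≈ ε) where

    conj : Carrier → Carrier
    conj x = d ∙ (x ∙ d)

    conj-cong : ∀ {x y} → x ≈ y → conj x ≈ conj y
    conj-cong x≈y = ∙-congˡ (∙-congʳ x≈y)

    conj-homo : ∀ x y → conj (x ∙ y) ≈ conj x ∙ conj y
    conj-homo x y = begin
      d ∙ ((x ∙ y) ∙ d)             ≈⟨ ∙-congˡ (assoc x y d) ⟩
      d ∙ (x ∙ (y ∙ d))             ≈⟨ ∙-congˡ (∙-congˡ (identityˡ (y ∙ d))) ⟨
      d ∙ (x ∙ (ε ∙ (y ∙ d)))       ≈⟨ ∙-congˡ (∙-congˡ (∙-congʳ d∙d≈ε)) ⟨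
      d ∙ (x ∙ ((d ∙ d) ∙ (y ∙ d))) ≈⟨ ∙-congˡ (∙-congˡ (assoc d d (y ∙ d))) ⟩
      d ∙ (x ∙ (d ∙ (d ∙ (y ∙ d)))) ≈⟨ ∙-congˡ (assoc x d (d ∙ (y ∙ d))) ⟨
      d ∙ ((x ∙ d) ∙ (d ∙ (y ∙ d))) ≈⟨ assoc d (x ∙ d) (d ∙ (y ∙ d)) ⟨
      (d ∙ (x ∙ d)) ∙ (d ∙ (y ∙ d)) ∎

    conj-ε : conj ε ≈ ε
    conj-ε = begin
      d ∙ (ε ∙ d) ≈⟨ ∙-congˡ (identityˡ d) ⟩
      d ∙ d       ≈⟨ d∙d≈ε ⟩
      ε           ∎

    conj-involutive : ∀ x → conj (conj x) ≈ x
    conj-involutive x = begin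
      d ∙ ((d ∙ (x ∙ d)) ∙ d) ≈⟨ ∙-congˡ (assoc d (x ∙ d) d) ⟩
      d ∙ (d ∙ ((x ∙ d) ∙ d)) ≈⟨ assoc d d ((x ∙ d) ∙ d) ⟨
      (d ∙ d) ∙ ((x ∙ d) ∙ d) ≈⟨ ∙-congʳ d∙d≈ε ⟩
      ε ∙ ((x ∙ d) ∙ d)       ≈⟨ identityˡ ((x ∙ d) ∙ d) ⟩
      (x ∙ d) ∙ d             ≈⟨ assoc x d d ⟩
      x ∙ (d ∙ d)             ≈⟨ ∙-congˡ d∙d≈ε ⟩
      x ∙ ε                   ≈⟨ identityʳ x ⟩
      x                       ∎

    conj-injective : ∀ {x y} → conj x ≈ conj y → x ≈ y
    conj-injective {x} {y} e = begin
      x             ≈⟨ conj-involutive x ⟨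
      conj (conj x) ≈⟨ conj-cong e ⟩
      conj (conj y) ≈⟨ conj-involutive y ⟩
      y             ∎

-- Imported only here: in scope above, this _≈_ would clash with the monoid equality.
open import Data.Fin.Permutation using (_≈_; id)

module _ {m : ℕ} where

  permMat : Permutation′ m → Mat m
  permMat σ i j = δ (σ ⟨$⟩ʳ i) j

  permMat-*M : ∀ σ (X : Mat m) i j → (permMat σ *M X) i j ≡ X (σ ⟨$⟩ʳ i) j
  permMat-*M σ X i j = trans (*M-sum (permMat σ) X i j) (sum-δ (σ ⟨$⟩ʳ i) (λ k → X k j))

  permMat-∘ₚ : ∀ σ ρ → permMat (σ ∘ₚ ρ) ≡M (permMat σ *M permMat ρ)
  permMat-∘ₚ σ ρ i j = sym (permMat-*M σ (permMat ρ) i j)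

  permMat-id : ∀ π → π ≈ id → permMat π ≡M 1M
  permMat-id π π≈id i j = cong (λ k → δ k j) (π≈id i)

  permMat-injective : ∀ {σ ρ} → permMat σ ≡M permMat ρ → σ ≈ ρ
  permMat-injective {σ} {ρ} e i = δ⇒≡ (trans (e i (ρ ⟨$⟩ʳ i)) (δ-refl (ρ ⟨$⟩ʳ i)))

  shear : Fin m → Mat m
  shear t i j = (not (δ t i) ∧ δ t j) xor δ i j

  shear-*M : ∀ t (X : Mat m) i j → (shear t *M X) i j ≡ (not (δ t i) ∧ X t j) xor X i j
  shear-*M t X i j = begin
    (shear t *M X) i j
      ≡⟨ *M-sum (shear t) X i j ⟩
    sum (λ k → ((c ∧ δ t k) xor δ i k) ∧ X k j)
      ≡⟨ sum-cong-≗ (λ k → distrib (δ t k) (δ i k) (X k j)) ⟩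
    sum (λ k → (c ∧ (δ t k ∧ X k j)) xor (δ i k ∧ X k j))
      ≡⟨ ∑-distrib-+ (λ k → c ∧ (δ t k ∧ X k j)) (λ k → δ i k ∧ X k j) ⟩
    sum (λ k → c ∧ (δ t k ∧ X k j)) xor sum (λ k → δ i k ∧ X k j)
      ≡⟨ cong (_xor _) (*-distribˡ-sum c (λ k → δ t k ∧ X k j)) ⟨
    (c ∧ sum (λ k → δ t k ∧ X k j)) xor sum (λ k → δ i k ∧ X k j)
      ≡⟨ cong₂ (λ a b → (c ∧ a) xor b) (sum-δ t (λ k → X k j)) (sum-δ i (λ k → X k j)) ⟩
    (c ∧ X t j) xor X i j
      ∎
    where
    open ≡-Reasoning
    c = not (δ t i)
    distrib : ∀ a b x → ((c ∧ a) xor b) ∧ x ≡ (c ∧ (a ∧ x)) xor (b ∧ x)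
    distrib a b x = trans (∧-distribʳ-xor x (c ∧ a) b) (cong (_xor (b ∧ x)) (∧-assoc c a x))

  shear-involutive : ∀ t → (shear t *M shear t) ≡M 1M
  shear-involutive t i j = begin
    (shear t *M shear t) i j
      ≡⟨ shear-*M t (shear t) i j ⟩
    (not (δ t i) ∧ shear t t j) xor shear t i j
      ≡⟨ cong (λ b → (not (δ t i) ∧ ((not b ∧ δ t j) xor δ t j)) xor shear t i j) (δ-refl t) ⟩
    (not (δ t i) ∧ δ t j) xor shear t i j
      ≡⟨ xor-cancelˡ (not (δ t i) ∧ δ t j) (δ i j) ⟩
    δ i j
      ∎
    where open ≡-Reasoning

-- For t = n+1, s = σ(t) and u = σ(i) the left side is Q σ i j and the right side is entry (i, j)
-- of S (P σ) S.
shear-conj-entry : ∀ {m} (t s u j : Fin m) →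
  δ (PC.transpose t s u) j xor (δ s j ∧ (not (δ t u) ∧ not (δ s t)))
  ≡ (not (δ s u) ∧ shear t s j) xor shear t u j
shear-conj-entry t s u j = by-cases (t ≟ s) (u ≟ t) (u ≟ s)
  where
  open ≡-Reasoning
  by-cases : Dec (t ≡ s) → Dec (u ≡ t) → Dec (u ≡ s) →
    δ (PC.transpose t s u) j xor (δ s j ∧ (not (δ t u) ∧ not (δ s t)))
    ≡ (not (δ s u) ∧ shear t s j) xor shear t u j
  by-cases (yes refl) _ _
    rewrite transpose-self t u | δ-refl t = begin
    δ u j xor (δ t j ∧ (not (δ t u) ∧ false))
      ≡⟨ cong (λ b → δ u j xor (δ t j ∧ b)) (∧-zeroʳ (not (δ t u))) ⟩
    δ u j xor (δ t j ∧ false)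
      ≡⟨ cong (δ u j xor_) (∧-zeroʳ (δ t j)) ⟩
    δ u j xor false
      ≡⟨ xor-identityʳ (δ u j) ⟩
    δ u j
      ≡⟨ xor-cancelˡ (not (δ t u) ∧ δ t j) (δ u j) ⟨
    (not (δ t u) ∧ δ t j) xor ((not (δ t u) ∧ δ t j) xor δ u j)
      ∎
  by-cases (no t≢s) (yes refl) _
    rewrite transpose-matchˡ u s | δ-refl u | δ-≢ t≢s | δ-≢ (≢-sym t≢s) = begin
    δ s j xor (δ s j ∧ false)   ≡⟨ cong (δ s j xor_) (∧-zeroʳ (δ s j)) ⟩
    δ s j xor false             ≡⟨ xor-identityʳ (δ s j) ⟩
    δ s j                       ≡⟨ xor-cancelˡ (δ u j) (δ s j) ⟨
    δ u j xor (δ u j xor δ s j) ≡⟨ xor-comm (δ u j) (δ u j xor δ s j) ⟩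
    (δ u j xor δ s j) xor δ u j ∎
  by-cases (no t≢s) (no u≢t) (yes refl)
    rewrite transpose-matchʳ u≢t | δ-refl u | δ-≢ t≢s | δ-≢ (≢-sym t≢s) =
    cong (δ t j xor_) (∧-identityʳ (δ u j))
  by-cases (no t≢s) (no u≢t) (no u≢s)
    rewrite transpose-other u≢t u≢s | δ-≢ (≢-sym u≢t) | δ-≢ (≢-sym u≢s) | δ-≢ t≢s | δ-≢ (≢-sym t≢s)
    = begin
    δ u j xor (δ s j ∧ true)                ≡⟨ cong (δ u j xor_) (∧-identityʳ (δ s j)) ⟩
    δ u j xor δ s j                         ≡⟨ xor-comm (δ u j) (δ s j) ⟩
    δ s j xor δ u j                         ≡⟨ xor-cancel-middle (δ t j) (δ s j) (δ u j) ⟨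
    (δ t j xor δ s j) xor (δ t j xor δ u j) ∎

Q≡shear-conj : ∀ {n} (σ : Sym n) → Q σ ≡M (shear (top n) *M (permMat σ *M shear (top n)))
Q≡shear-conj {n} σ i j = begin
  Q σ i j
    ≡⟨ shear-conj-entry t s u j ⟩
  (not (δ s u) ∧ shear t s j) xor shear t u j
    ≡⟨ cong (λ b → (not b ∧ shear t s j) xor shear t u j) (δ-permute σ t i) ⟩
  (not (δ t i) ∧ shear t s j) xor shear t u j
    ≡⟨ cong₂ (λ a b → (not (δ t i) ∧ a) xor b)
             (permMat-*M σ (shear t) t j) (permMat-*M σ (shear t) i j) ⟨
  (not (δ t i) ∧ (permMat σ *M shear t) t j) xor (permMat σ *M shear t) i j
    ≡⟨ shear-*M t (permMat σ *M shear t) i j ⟨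
  (shear t *M (permMat σ *M shear t)) i j
    ∎
  where
  open ≡-Reasoning
  t = top n
  s = σ ⟨$⟩ʳ t
  u = σ ⟨$⟩ʳ i

module _ {n : ℕ} where

  open Conjugation.ByInvolution (*M-monoid {ℕ.suc n}) (shear (top n)) (shear-involutive (top n))
  open import Relation.Binary.Reasoning.Setoid (Monoid.setoid (*M-monoid {ℕ.suc n}))

  Q-homo : ∀ (σ ρ : Sym n) → Q (σ · ρ) ≡M (Q σ *M Q ρ)
  Q-homo σ ρ = begin
    Q (σ · ρ)                            ≈⟨ Q≡shear-conj (σ · ρ) ⟩
    conj (permMat (σ · ρ))               ≈⟨ conj-cong (permMat-∘ₚ σ ρ) ⟩
    conj (permMat σ *M permMat ρ)        ≈⟨ conj-homo (permMat σ) (permMat ρ) ⟩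
    conj (permMat σ) *M conj (permMat ρ) ≈⟨ *M-cong (Q≡shear-conj σ) (Q≡shear-conj ρ) ⟨
    Q σ *M Q ρ                           ∎

  Q-id : ∀ (π : Sym n) → π ≈ id → Q π ≡M 1M
  Q-id π π≈id = begin
    Q π              ≈⟨ Q≡shear-conj π ⟩
    conj (permMat π) ≈⟨ conj-cong (permMat-id π π≈id) ⟩
    conj 1M          ≈⟨ conj-ε ⟩
    1M               ∎

  Q-invertible : ∀ (σ : Sym n) → Invertible (Q σ)
  Q-invertible σ = record
    { inv  = Q (flip σ)
    ; invˡ = begin
        Q (flip σ) *M Q σ ≈⟨ Q-homo (flip σ) σ ⟨
        Q (flip σ · σ)    ≈⟨ Q-id (flip σ · σ) (λ _ → inverseʳ σ) ⟩
        1M                ∎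
    ; invʳ = begin
        Q σ *M Q (flip σ) ≈⟨ Q-homo σ (flip σ) ⟨
        Q (σ · flip σ)    ≈⟨ Q-id (σ · flip σ) (λ _ → inverseˡ σ) ⟩
        1M                ∎
    }

  Q-injective : ∀ (σ ρ : Sym n) → Q σ ≡M Q ρ → σ ≈ ρ
  Q-injective σ ρ Qσ≡Qρ = permMat-injective {σ = σ} {ρ} (conj-injective (begin
    conj (permMat σ) ≈⟨ Q≡shear-conj σ ⟨
    Q σ              ≈⟨ Qσ≡Qρ ⟩
    Q ρ              ≈⟨ Q≡shear-conj ρ ⟩
    conj (permMat ρ) ∎))

mainTheorem5 : (n : ℕ) → 1 ≤ n →
    ((σ : Sym n) → Invertible (Q σ))
    × ((σ ρ : Sym n) → Q (σ · ρ) ≡M (Q σ *M Q ρ))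
    × ((σ ρ : Sym n) → Q σ ≡M Q ρ → σ ≈ ρ)
mainTheorem5 n _ = Q-invertible , Q-homo , Q-injective
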